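{- Let $G$ be a graph of order $n\ge 3$ with maximum degree $\Delta(G)=n-2$. Then $\gamma(G)=2$ and $DV_G(v)\le n-1$ for every $v\in V(G)$. Further, if $\deg_G(v)=n-2$, then $DV_G(v)=|N[w]|$, where $w$ is the unique vertex with $w\neq v$ and $vw\notin E(G)$.
   Context: All graphs are finite, simple and undirected. $N[w]$ is the closed neighborhood of $w$. A set $D\subseteq V(G)$ is a dominating set of $G$ if every vertex not in $D$ is adjacent to at least one vertex of $D$. The domination number $\gamma(G)$ is the minimum cardinality of a dominating set; a dominating set of cardinality $\gamma(G)$ is a $\gamma(G)$-set. For $v\in V(G)$, $DV_G(v)$ is the number of $\gamma(G)$-sets containing $v$. -}

module Defs where

open import Data.Nat using (ℕ; _≤_)
open import Data.Bool using (Bool; true; false; _∨_)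
open import Data.Fin using (Fin; _≟_)
open import Data.Fin.Subset using (Subset; _∈_; ∣_∣)
open import Data.Vec using (tabulate)
open import Data.List using (List; length)
open import Data.List.Relation.Unary.Unique.Propositional using (Unique)
import Data.List.Membership.Propositional as LM
open import Data.Product using (Σ; ∃; _×_)
open import Data.Sum using (_⊎_)
open import Relation.Nullary using (does)
open import Relation.Binary.PropositionalEquality using (_≡_)
open import Function.Bundles using (_⇔_)

record Graph (n : ℕ) : Set where
  field
    adj   : Fin n → Fin n → Bool
    sym   : ∀ u v → adj u v ≡ adj v u
    irrefl : ∀ v → adj v v ≡ false
open Graph public

module _ {n : ℕ} (G : Graph n) where

  Adj : Fin n → Fin n → Set
  Adj u v = adj G u v ≡ true

  N : Fin n → Subset n
  N v = tabulate (λ u → adj G v u)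

  N[_] : Fin n → Subset n
  N[ w ] = tabulate (λ u → does (u ≟ w) ∨ adj G w u)

  deg : Fin n → ℕ
  deg v = ∣ N v ∣

  MaxDegree : ℕ → Set
  MaxDegree d = (∀ v → deg v ≤ d) × ∃ (λ v → deg v ≡ d)

  Dominating : Subset n → Set
  Dominating D = ∀ v → v ∈ D ⊎ ∃ (λ u → u ∈ D × Adj u v)

  DominationNumber : ℕ → Set
  DominationNumber k =
    (∃ λ D → Dominating D × ∣ D ∣ ≡ k) × (∀ D → Dominating D → k ≤ ∣ D ∣)

  GammaSet : Subset n → Set
  GammaSet D = Dominating D × (∀ D′ → Dominating D′ → ∣ D ∣ ≤ ∣ D′ ∣)

-- Cardinality of a set of subsets: P has exactly m elements, witnessed by a
-- duplicate-free list enumerating exactly the subsets satisfying P.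
HasCard : {n : ℕ} → (Subset n → Set) → ℕ → Set
HasCard {n} P m =
  Σ (List (Subset n)) λ Ds → Unique Ds × length Ds ≡ m × (∀ D → (D LM.∈ Ds) ⇔ P D)

DV : {n : ℕ} → Graph n → Fin n → ℕ → Set
DV G v m = HasCard (λ D → GammaSet G D × v ∈ D) m

-- A vertex v of degree n − 2 misses exactly one vertex w ≠ v, so {v, u} dominates
-- G precisely when u ∈ N[w]: v covers everything except w, and w must be covered
-- by u.  Since Δ(G) < n − 1 no single vertex dominates, hence γ(G) = 2, the
-- γ(G)-sets are the dominating pairs, and those containing any vertex v are
-- {v, u} for at most n − 1 choices of u ≠ v.
module Submission where

open import Defs hiding (sym)
open import Data.Nat using (ℕ; _≤_; _∸_; suc; _+_; s≤s; z≤n)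
open import Data.Nat.Properties
  using (≤-trans; ≤-antisym; +-suc; +-monoʳ-≤; n≤1+n; 1+n≰n; ∸-monoˡ-≤; m∸[m∸n]≡n; module ≤-Reasoning)
open import Data.Bool using (Bool; true; false; _∨_)
import Data.Bool as Bool
open import Data.Fin using (Fin; _≟_; fromℕ<)
import Data.Fin as Fin
open import Data.Fin.Properties using (any?; ¬∀⟶∃¬; suc-injective)
open import Data.Fin.Subset using (Subset; _∈_; _⊆_; ∣_∣; ⁅_⁆; _∪_; ∁)
open import Data.Fin.Subset.Properties
  using (_∈?_; x∈⁅x⁆; x∈⁅y⁆⇒x≡y; ∣⁅x⁆∣≡1; x∈p∪q⁺; x∈p∪q⁻; ⊆-antisym; p⊆q⇒∣p∣≤∣q∣;
         x∈p⇒∣p-x∣<∣p∣; x∈p∧x≢y⇒x∈p-y; ∣∁p∣≡n∸∣p∣; x∉p⇒x∈∁p; x∈∁p⇒x∉p)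
open import Data.Vec using ([]; _∷_; tabulate)
import Data.Vec as Vec
open import Data.Vec.Properties using (lookup∘tabulate; []=⇒lookup; lookup⇒[]=; ≡-dec)
open import Data.List using (List; []; _∷_; length; map; filter; allFin)
open import Data.List.Properties using (length-map; length-filter; length-tabulate)
open import Data.List.Relation.Unary.Unique.Propositional using (Unique)
open import Data.List.Relation.Unary.Unique.Propositional.Properties using (map⁺; allFin⁺; filter⁺)
open import Data.List.Relation.Unary.AllPairs using ([]; _∷_)
open import Data.List.Relation.Unary.All as All using (All; []; _∷_)
open import Data.List.Relation.Unary.Any using (here; there)
open import Data.List.Membership.Propositional using () renaming (_∈_ to _∈ₗ_)
open import Data.List.Membership.Propositional.Properties
  using (∈-filter⁺; ∈-filter⁻; ∈-map⁺; ∈-map⁻; ∈-allFin)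
open import Data.List.Membership.Propositional.Properties.WithK using (unique∧set⇒bag)
open import Data.List.Relation.Binary.BagAndSetEquality using (∼bag⇒↭)
open import Data.List.Relation.Binary.Permutation.Propositional.Properties using (↭-length)
open import Data.Product using (_×_; _,_; proj₁; proj₂; ∃; uncurry)
open import Data.Sum using (_⊎_; inj₁; inj₂)
open import Function.Bundles using (_⇔_; mk⇔; Equivalence)
open import Function.Construct.Composition using (_⇔-∘_)
open import Function.Construct.Symmetry using (⇔-sym)
open import Relation.Nullary using (¬_; Dec; yes; no; does; contradiction)
open import Relation.Nullary.Decidable using (_×-dec_; _⊎-dec_; ¬?)
open import Relation.Binary.Definitions using (DecidableEquality)
open import Relation.Binary.PropositionalEquality
  using (_≡_; _≢_; refl; sym; trans; cong; subst; subst₂; ≢-sym; module ≡-Reasoning)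

-- Lengths of duplicate-free lists

module _ {a} {A : Set a} where

  length-unique-set : {xs ys : List A} → Unique xs → Unique ys →
    (∀ {x} → x ∈ₗ xs ⇔ x ∈ₗ ys) → length xs ≡ length ys
  length-unique-set uxs uys xs⇔ys = ↭-length (∼bag⇒↭ (unique∧set⇒bag uxs uys xs⇔ys))

  module _ (_≟ₐ_ : DecidableEquality A) where
    open import Data.List.Membership.DecPropositional _≟ₐ_ using () renaming (_∈?_ to _∈ₗ?_)

    length-unique-⊆ : {xs ys : List A} → Unique xs → Unique ys →
      (∀ {x} → x ∈ₗ xs → x ∈ₗ ys) → length xs ≤ length ys
    length-unique-⊆ {xs} {ys} uxs uys xs⊆ys = begin
      length xs                    ≡⟨ length-unique-set uxs (filter⁺ (_∈ₗ? xs) {ys} uys) xs⇔ ⟩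
      length (filter (_∈ₗ? xs) ys) ≤⟨ length-filter (_∈ₗ? xs) ys ⟩
      length ys                    ∎
      where
      open ≤-Reasoning
      xs⇔ : ∀ {x} → x ∈ₗ xs ⇔ x ∈ₗ filter (_∈ₗ? xs) ys
      xs⇔ = mk⇔ (λ x∈xs → ∈-filter⁺ (_∈ₗ? xs) (xs⊆ys x∈xs) x∈xs)
                (λ x∈ → proj₂ (∈-filter⁻ (_∈ₗ? xs) {xs = ys} x∈))

HasCard-unique : ∀ {n} {P : Subset n → Set} {m k} → HasCard P m → HasCard P k → m ≡ k
HasCard-unique (Ds , uDs , refl , Ds⇔P) (Es , uEs , refl , Es⇔P) =
  length-unique-set uDs uEs (λ {D} → ⇔-sym (Es⇔P D) ⇔-∘ Ds⇔P D)

-- Subsets of Fin n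

∣p∪q∣≤∣p∣+∣q∣ : ∀ {n} (p q : Subset n) → ∣ p ∪ q ∣ ≤ ∣ p ∣ + ∣ q ∣
∣p∪q∣≤∣p∣+∣q∣ []          []          = z≤n
∣p∪q∣≤∣p∣+∣q∣ (true  ∷ p) (true  ∷ q) = s≤s (≤-trans (∣p∪q∣≤∣p∣+∣q∣ p q) (+-monoʳ-≤ ∣ p ∣ (n≤1+n ∣ q ∣)))
∣p∪q∣≤∣p∣+∣q∣ (true  ∷ p) (false ∷ q) = s≤s (∣p∪q∣≤∣p∣+∣q∣ p q)
∣p∪q∣≤∣p∣+∣q∣ (false ∷ p) (true  ∷ q) =
  subst (suc ∣ p ∪ q ∣ ≤_) (sym (+-suc ∣ p ∣ ∣ q ∣)) (s≤s (∣p∪q∣≤∣p∣+∣q∣ p q))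
∣p∪q∣≤∣p∣+∣q∣ (false ∷ p) (false ∷ q) = ∣p∪q∣≤∣p∣+∣q∣ p q

module _ {n : ℕ} where

  ∈-tabulate⁺ : {f : Fin n → Bool} {x : Fin n} → f x ≡ true → x ∈ tabulate f
  ∈-tabulate⁺ {f} {x} fx = lookup⇒[]= x _ (trans (lookup∘tabulate f x) fx)

  ∈-tabulate⁻ : {f : Fin n → Bool} {x : Fin n} → x ∈ tabulate f → f x ≡ true
  ∈-tabulate⁻ {f} {x} x∈ = trans (sym (lookup∘tabulate f x)) ([]=⇒lookup x∈)

  2≤∣p∣ : {p : Subset n} {x y : Fin n} → x ∈ p → y ∈ p → x ≢ y → 2 ≤ ∣ p ∣
  2≤∣p∣ x∈p y∈p x≢y =
    ≤-trans (s≤s (≤-trans (s≤s z≤n) (x∈p⇒∣p-x∣<∣p∣ (x∈p∧x≢y⇒x∈p-y y∈p (≢-sym x≢y)))))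
            (x∈p⇒∣p-x∣<∣p∣ x∈p)

  3≤∣p∣ : {p : Subset n} {x y z : Fin n} → x ∈ p → y ∈ p → z ∈ p →
    x ≢ y → x ≢ z → y ≢ z → 3 ≤ ∣ p ∣
  3≤∣p∣ x∈p y∈p z∈p x≢y x≢z y≢z =
    ≤-trans (s≤s (2≤∣p∣ (x∈p∧x≢y⇒x∈p-y y∈p (≢-sym x≢y)) (x∈p∧x≢y⇒x∈p-y z∈p (≢-sym x≢z)) y≢z))
            (x∈p⇒∣p-x∣<∣p∣ x∈p)

  ⊆⁅x⁆⊎∃≢ : {p : Subset n} {x : Fin n} → x ∈ p → p ⊆ ⁅ x ⁆ ⊎ ∃ λ y → y ∈ p × y ≢ x
  ⊆⁅x⁆⊎∃≢ {p} {x} x∈p with any? (λ y → (y ∈? p) ×-dec ¬? (y ≟ x))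
  ... | yes (y , y∈p , y≢x) = inj₂ (y , y∈p , y≢x)
  ... | no ∄y = inj₁ p⊆⁅x⁆
    where
    p⊆⁅x⁆ : p ⊆ ⁅ x ⁆
    p⊆⁅x⁆ {y} y∈p with y ≟ x
    ... | yes refl = x∈⁅x⁆ x
    ... | no y≢x = contradiction (y , y∈p , y≢x) ∄y


  pair : Fin n → Fin n → Subset n
  pair x y = ⁅ x ⁆ ∪ ⁅ y ⁆

  x∈pair : (x y : Fin n) → x ∈ pair x y
  x∈pair x y = x∈p∪q⁺ (inj₁ (x∈⁅x⁆ x))

  y∈pair : (x y : Fin n) → y ∈ pair x y
  y∈pair x y = x∈p∪q⁺ (inj₂ (x∈⁅x⁆ y))

  ∈pair⁻ : {x y z : Fin n} → z ∈ pair x y → z ≡ x ⊎ z ≡ y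
  ∈pair⁻ {x} {y} z∈ with x∈p∪q⁻ ⁅ x ⁆ ⁅ y ⁆ z∈
  ... | inj₁ z∈⁅x⁆ = inj₁ (x∈⁅y⁆⇒x≡y x z∈⁅x⁆)
  ... | inj₂ z∈⁅y⁆ = inj₂ (x∈⁅y⁆⇒x≡y y z∈⁅y⁆)

  ∣pair∣≤2 : (x y : Fin n) → ∣ pair x y ∣ ≤ 2
  ∣pair∣≤2 x y = begin
    ∣ ⁅ x ⁆ ∪ ⁅ y ⁆ ∣     ≤⟨ ∣p∪q∣≤∣p∣+∣q∣ ⁅ x ⁆ ⁅ y ⁆ ⟩
    ∣ ⁅ x ⁆ ∣ + ∣ ⁅ y ⁆ ∣ ≡⟨ cong (_+ ∣ ⁅ y ⁆ ∣) (∣⁅x⁆∣≡1 x) ⟩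
    1 + ∣ ⁅ y ⁆ ∣         ≡⟨ cong (1 +_) (∣⁅x⁆∣≡1 y) ⟩
    2                     ∎
    where open ≤-Reasoning

  ∣pair∣≡2 : {x y : Fin n} → x ≢ y → ∣ pair x y ∣ ≡ 2
  ∣pair∣≡2 {x} {y} x≢y = ≤-antisym (∣pair∣≤2 x y) (2≤∣p∣ (x∈pair x y) (y∈pair x y) x≢y)

  pair-injectiveʳ : {x y z : Fin n} → pair x y ≡ pair x z → y ≡ z
  pair-injectiveʳ {x} {y} {z} eq with ∈pair⁻ (subst (y ∈_) eq (y∈pair x y))
                                    | ∈pair⁻ (subst (z ∈_) (sym eq) (y∈pair x z))
  ... | inj₂ y≡z | _        = y≡z
  ... | inj₁ y≡x | inj₁ z≡x = trans y≡x (sym z≡x)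
  ... | inj₁ _   | inj₂ z≡y = sym z≡y

  ∣p∣≡2⇒p≡pair : {p : Subset n} {x : Fin n} → ∣ p ∣ ≡ 2 → x ∈ p →
    ∃ λ y → y ≢ x × p ≡ pair x y
  ∣p∣≡2⇒p≡pair {p} {x} ∣p∣≡2 x∈p with ⊆⁅x⁆⊎∃≢ x∈p
  ... | inj₁ p⊆⁅x⁆ = contradiction (subst₂ _≤_ ∣p∣≡2 (∣⁅x⁆∣≡1 x) (p⊆q⇒∣p∣≤∣q∣ p⊆⁅x⁆)) 1+n≰n
  ... | inj₂ (y , y∈p , y≢x) = y , y≢x , ⊆-antisym p⊆pair pair⊆p
    where
    p⊆pair : p ⊆ pair x y
    p⊆pair {z} z∈p with z ≟ x | z ≟ y
    ... | yes refl | _        = x∈pair x y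
    ... | no _     | yes refl = y∈pair x y
    ... | no z≢x   | no z≢y   =
      contradiction (subst (3 ≤_) ∣p∣≡2 (3≤∣p∣ x∈p y∈p z∈p (≢-sym y≢x) (≢-sym z≢x) (≢-sym z≢y))) 1+n≰n
    pair⊆p : pair x y ⊆ p
    pair⊆p z∈ with ∈pair⁻ z∈
    ... | inj₁ refl = x∈p
    ... | inj₂ refl = y∈p

toList : ∀ {n} → Subset n → List (Fin n)
toList []          = []
toList (true  ∷ p) = Fin.zero ∷ map Fin.suc (toList p)
toList (false ∷ p) = map Fin.suc (toList p)

length-toList : ∀ {n} (p : Subset n) → length (toList p) ≡ ∣ p ∣
length-toList []          = refl
length-toList (true  ∷ p) = cong suc (trans (length-map Fin.suc (toList p)) (length-toList p))
length-toList (false ∷ p) = trans (length-map Fin.suc (toList p)) (length-toList p)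

∈-toList⁺ : ∀ {n} {p : Subset n} {x} → x ∈ p → x ∈ₗ toList p
∈-toList⁺ {p = true  ∷ p} Vec.here       = here refl
∈-toList⁺ {p = true  ∷ p} (Vec.there x∈) = there (∈-map⁺ Fin.suc (∈-toList⁺ x∈))
∈-toList⁺ {p = false ∷ p} (Vec.there x∈) = ∈-map⁺ Fin.suc (∈-toList⁺ x∈)

∈-toList⁻ : ∀ {n} {p : Subset n} {x} → x ∈ₗ toList p → x ∈ p
∈-toList⁻ {p = true  ∷ p} (here refl) = Vec.here
∈-toList⁻ {p = true  ∷ p} (there x∈) with ∈-map⁻ Fin.suc x∈
... | _ , y∈ , refl = Vec.there (∈-toList⁻ y∈)
∈-toList⁻ {p = false ∷ p} x∈ with ∈-map⁻ Fin.suc x∈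
... | _ , y∈ , refl = Vec.there (∈-toList⁻ y∈)

toList-unique : ∀ {n} (p : Subset n) → Unique (toList p)
toList-unique []          = []
toList-unique (true  ∷ p) = zero∉ (toList p) ∷ map⁺ suc-injective (toList-unique p)
  where
  zero∉ : ∀ {n} (xs : List (Fin n)) → All (Fin.zero ≢_) (map Fin.suc xs)
  zero∉ []       = []
  zero∉ (_ ∷ xs) = (λ ()) ∷ zero∉ xs
toList-unique (false ∷ p) = map⁺ suc-injective (toList-unique p)

-- Neighbourhoods and dominating pairs

module _ {n : ℕ} (G : Graph n) where

  Adj? : (u v : Fin n) → Dec (Adj G u v)
  Adj? u v = adj G u v Bool.≟ true

  Adj-sym : {u v : Fin n} → Adj G u v → Adj G v u
  Adj-sym {u} {v} = trans (Graph.sym G v u)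

  ¬Adj-refl : (v : Fin n) → ¬ Adj G v v
  ¬Adj-refl v vv with () ← trans (sym (irrefl G v)) vv

  ∈N⁺ : {v x : Fin n} → Adj G v x → x ∈ N G v
  ∈N⁺ = ∈-tabulate⁺

  ∈N⁻ : {v x : Fin n} → x ∈ N G v → Adj G v x
  ∈N⁻ = ∈-tabulate⁻

  ∈N[]⁺ : {w x : Fin n} → x ≡ w ⊎ Adj G w x → x ∈ N[_] G w
  ∈N[]⁺ {w} {x} x∼w = ∈-tabulate⁺ (closed x∼w)
    where
    closed : x ≡ w ⊎ Adj G w x → does (x ≟ w) ∨ adj G w x ≡ true
    closed x∼w with x ≟ w | x∼w
    ... | yes _   | _          = refl
    ... | no x≢w  | inj₁ x≡w   = contradiction x≡w x≢w
    ... | no _    | inj₂ w∼x   = w∼x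

  ∈N[]⁻ : {w x : Fin n} → x ∈ N[_] G w → x ≡ w ⊎ Adj G w x
  ∈N[]⁻ {w} {x} x∈ with x ≟ w | ∈-tabulate⁻ {f = λ z → does (z ≟ w) ∨ adj G w z} x∈
  ... | yes x≡w | _   = inj₁ x≡w
  ... | no _    | w∼x = inj₂ w∼x

  Universal : Fin n → Set
  Universal y = ∀ x → x ≡ y ⊎ Adj G y x

  universal⇒n∸1≤deg : {y : Fin n} → Universal y → n ∸ 1 ≤ deg G y
  universal⇒n∸1≤deg {y} univ = begin
    n ∸ 1             ≡⟨ cong (n ∸_) (∣⁅x⁆∣≡1 y) ⟨
    n ∸ ∣ ⁅ y ⁆ ∣     ≡⟨ ∣∁p∣≡n∸∣p∣ ⁅ y ⁆ ⟨
    ∣ ∁ ⁅ y ⁆ ∣       ≤⟨ p⊆q⇒∣p∣≤∣q∣ ∁⁅y⁆⊆N ⟩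
    deg G y           ∎
    where
    open ≤-Reasoning
    ∁⁅y⁆⊆N : ∁ ⁅ y ⁆ ⊆ N G y
    ∁⁅y⁆⊆N {x} x∈ with univ x
    ... | inj₁ refl = contradiction (x∈⁅x⁆ y) (x∈∁p⇒x∉p x∈)
    ... | inj₂ y∼x  = ∈N⁺ y∼x

  ¬universal⇒non-neighbour : {v : Fin n} → ¬ Universal v → ∃ λ w → w ≢ v × ¬ Adj G v w
  ¬universal⇒non-neighbour {v} ¬univ
    with w , ¬w∼v ← ¬∀⟶∃¬ n _ (λ x → (x ≟ v) ⊎-dec Adj? v x) ¬univ
    = w , (λ w≡v → ¬w∼v (inj₁ w≡v)) , (λ v∼w → ¬w∼v (inj₂ v∼w))

  dominating⇒∃∈ : Fin n → {D : Subset n} → Dominating G D → ∃ (_∈ D)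
  dominating⇒∃∈ x₀ dom with dom x₀
  ... | inj₁ x₀∈D          = x₀ , x₀∈D
  ... | inj₂ (u , u∈D , _) = u , u∈D

  dominating⇒2≤∣D∣ : (∀ y → ¬ Universal y) → Fin n →
    {D : Subset n} → Dominating G D → 2 ≤ ∣ D ∣
  dominating⇒2≤∣D∣ ¬univ x₀ {D} dom
    with y , y∈D ← dominating⇒∃∈ x₀ dom
    with ⊆⁅x⁆⊎∃≢ y∈D
  ... | inj₂ (z , z∈D , z≢y) = 2≤∣p∣ z∈D y∈D z≢y
  ... | inj₁ D⊆⁅y⁆          = contradiction univ (¬univ y)
    where
    ≡y : ∀ {x} → x ∈ D → x ≡ y
    ≡y x∈D = x∈⁅y⁆⇒x≡y y (D⊆⁅y⁆ x∈D)
    univ : Universal y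
    univ x with dom x
    ... | inj₁ x∈D             = inj₁ (≡y x∈D)
    ... | inj₂ (u , u∈D , u∼x) = inj₂ (subst (λ u → Adj G u x) (≡y u∈D) u∼x)

  module _ {v w : Fin n} (2≤n : 2 ≤ n) (deg≡n∸2 : deg G v ≡ n ∸ 2) (w≢v : w ≢ v) (v≁w : ¬ Adj G v w) where

    Adj-except-w : {x : Fin n} → x ≢ v → x ≢ w → Adj G v x
    Adj-except-w {x} x≢v x≢w with Adj? v x
    ... | yes v∼x = v∼x
    ... | no v≁x  = contradiction (subst (3 ≤_) ∣∁N∣≡2 three-non-neighbours) 1+n≰n
      where
      ∉N : {y : Fin n} → ¬ Adj G v y → y ∈ ∁ (N G v)
      ∉N v≁y = x∉p⇒x∈∁p (λ y∈N → v≁y (∈N⁻ y∈N))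
      three-non-neighbours : 3 ≤ ∣ ∁ (N G v) ∣
      three-non-neighbours =
        3≤∣p∣ (∉N (¬Adj-refl v)) (∉N v≁w) (∉N v≁x) (≢-sym w≢v) (≢-sym x≢v) (≢-sym x≢w)
      ∣∁N∣≡2 : ∣ ∁ (N G v) ∣ ≡ 2
      ∣∁N∣≡2 = begin
        ∣ ∁ (N G v) ∣  ≡⟨ ∣∁p∣≡n∸∣p∣ (N G v) ⟩
        n ∸ deg G v    ≡⟨ cong (n ∸_) deg≡n∸2 ⟩
        n ∸ (n ∸ 2)    ≡⟨ m∸[m∸n]≡n 2≤n ⟩
        2              ∎
        where open ≡-Reasoning

    pair-dominating : {u : Fin n} → u ∈ N[_] G w → Dominating G (pair v u)
    pair-dominating {u} u∈N[w] x with x ≟ v | x ≟ u | x ≟ w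
    ... | yes refl | _        | _        = inj₁ (x∈pair v u)
    ... | no _     | yes refl | _        = inj₁ (y∈pair v u)
    ... | no x≢v   | no x≢u   | no x≢w   = inj₂ (v , x∈pair v u , Adj-except-w x≢v x≢w)
    ... | no _     | no x≢u   | yes refl with ∈N[]⁻ u∈N[w]
    ...   | inj₁ u≡w = contradiction (sym u≡w) x≢u
    ...   | inj₂ w∼u = inj₂ (u , y∈pair v u , Adj-sym w∼u)

  pair-dominating⇒∈N[] : {v w u : Fin n} → w ≢ v → ¬ Adj G v w →
    Dominating G (pair v u) → u ∈ N[_] G w
  pair-dominating⇒∈N[] {w = w} w≢v v≁w dom with dom w
  ... | inj₁ w∈ with ∈pair⁻ w∈
  ...   | inj₁ w≡v = contradiction w≡v w≢v
  ...   | inj₂ w≡u = ∈N[]⁺ (inj₁ (sym w≡u))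
  pair-dominating⇒∈N[] w≢v v≁w dom | inj₂ (y , y∈ , y∼w) with ∈pair⁻ y∈
  ...   | inj₁ refl = contradiction y∼w v≁w
  ...   | inj₂ refl = ∈N[]⁺ (inj₂ (Adj-sym y∼w))

-- Graphs with Δ(G) = n − 2

module MaxDegree-n∸2 {n : ℕ} (G : Graph n) (3≤n : 3 ≤ n) (Δ≡n∸2 : MaxDegree G (n ∸ 2)) where

  2≤n : 2 ≤ n
  2≤n = ≤-trans (n≤1+n 2) 3≤n

  ¬universal : ∀ y → ¬ Universal G y
  ¬universal y univ = n∸1≰n∸2 3≤n (≤-trans (universal⇒n∸1≤deg G univ) (proj₁ Δ≡n∸2 y))
    where
    n∸1≰n∸2 : ∀ {n} → 3 ≤ n → ¬ (n ∸ 1 ≤ n ∸ 2)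
    n∸1≰n∸2 (s≤s (s≤s (s≤s _))) = 1+n≰n

  2≤∣D∣ : {D : Subset n} → Dominating G D → 2 ≤ ∣ D ∣
  2≤∣D∣ = dominating⇒2≤∣D∣ G ¬universal (fromℕ< 3≤n)

  dominating-pair : ∃ λ v → ∃ λ w → w ≢ v × Dominating G (pair v w)
  dominating-pair
    with v , deg≡n∸2 ← proj₂ Δ≡n∸2
    with w , w≢v , v≁w ← ¬universal⇒non-neighbour G (¬universal v)
    = v , w , w≢v , pair-dominating G 2≤n deg≡n∸2 w≢v v≁w (∈N[]⁺ G (inj₁ refl))

  γ-set⇒∣D∣≡2 : {D : Subset n} → GammaSet G D → ∣ D ∣ ≡ 2
  γ-set⇒∣D∣≡2 (dom , minimal) with v , w , _ , dom₀ ← dominating-pair =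
    ≤-antisym (≤-trans (minimal _ dom₀) (∣pair∣≤2 v w)) (2≤∣D∣ dom)

  dominating⇒γ-set : {D : Subset n} → Dominating G D → ∣ D ∣ ≤ 2 → GammaSet G D
  dominating⇒γ-set dom ∣D∣≤2 = dom , λ _ dom′ → ≤-trans ∣D∣≤2 (2≤∣D∣ dom′)

  γ-set∋v⇒pair : {D : Subset n} {v : Fin n} → GammaSet G D → v ∈ D →
    ∃ λ u → u ≢ v × D ≡ pair v u
  γ-set∋v⇒pair γD = ∣p∣≡2⇒p≡pair (γ-set⇒∣D∣≡2 γD)

  γ≡2 : DominationNumber G 2
  γ≡2 with v , w , w≢v , dom ← dominating-pair =
    (pair v w , dom , ∣pair∣≡2 (≢-sym w≢v)) , λ _ → 2≤∣D∣

  -- pair v v is not a γ(G)-set, so it can be added to an enumeration of the γ(G)-sets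
  -- containing v, and all of them lie among the n sets pair v u.
  DV≤n∸1 : ∀ v m → DV G v m → m ≤ n ∸ 1
  DV≤n∸1 v m (Ds , uDs , refl , Ds⇔) = ∸-monoˡ-≤ 1 (begin
    length (pair v v ∷ Ds)           ≤⟨ length-unique-⊆ (≡-dec Bool._≟_) (pair-v-v∉Ds ∷ uDs) unique-pairs ⊆pairs ⟩
    length (map (pair v) (allFin n)) ≡⟨ length-map (pair v) (allFin n) ⟩
    length (allFin n)                ≡⟨ length-tabulate (λ x → x) ⟩
    n                                ∎)
    where
    open ≤-Reasoning
    pairs-from-Ds : ∀ {D} → D ∈ₗ Ds → ∃ λ u → u ≢ v × D ≡ pair v u
    pairs-from-Ds D∈Ds = uncurry γ-set∋v⇒pair (Equivalence.to (Ds⇔ _) D∈Ds)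
    pair-v-v∉Ds : All (pair v v ≢_) Ds
    pair-v-v∉Ds = All.tabulate λ D∈Ds vv≡D →
      let u , u≢v , D≡vu = pairs-from-Ds D∈Ds in u≢v (sym (pair-injectiveʳ (trans vv≡D D≡vu)))
    unique-pairs : Unique (map (pair v) (allFin n))
    unique-pairs = map⁺ pair-injectiveʳ (allFin⁺ n)
    ⊆pairs : ∀ {D} → D ∈ₗ pair v v ∷ Ds → D ∈ₗ map (pair v) (allFin n)
    ⊆pairs (here refl) = ∈-map⁺ (pair v) (∈-allFin v)
    ⊆pairs (there D∈Ds) with u , _ , refl ← pairs-from-Ds D∈Ds = ∈-map⁺ (pair v) (∈-allFin u)

  DV≡∣N[w]∣ : ∀ v → deg G v ≡ n ∸ 2 → ∀ w → w ≢ v → ¬ Adj G v w →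
    ∀ m → DV G v m → m ≡ ∣ N[_] G w ∣
  DV≡∣N[w]∣ v deg≡n∸2 w w≢v v≁w m DVm = HasCard-unique DVm (Es , uEs , lengthEs , Es⇔)
    where
    Es : List (Subset n)
    Es = map (pair v) (toList (N[_] G w))
    uEs : Unique Es
    uEs = map⁺ pair-injectiveʳ (toList-unique (N[_] G w))
    lengthEs : length Es ≡ ∣ N[_] G w ∣
    lengthEs = trans (length-map (pair v) (toList (N[_] G w))) (length-toList (N[_] G w))
    Es⇔ : ∀ D → D ∈ₗ Es ⇔ (GammaSet G D × v ∈ D)
    Es⇔ D = mk⇔ to from
      where
      to : D ∈ₗ Es → GammaSet G D × v ∈ D
      to D∈Es with u , u∈ , refl ← ∈-map⁻ (pair v) D∈Es =
        dominating⇒γ-set (pair-dominating G 2≤n deg≡n∸2 w≢v v≁w (∈-toList⁻ u∈)) (∣pair∣≤2 v u)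
        , x∈pair v u
      from : GammaSet G D × v ∈ D → D ∈ₗ Es
      from (γD , v∈D) with u , _ , refl ← γ-set∋v⇒pair γD v∈D =
        ∈-map⁺ (pair v) (∈-toList⁺ (pair-dominating⇒∈N[] G w≢v v≁w (proj₁ γD)))

proposition2p10 : (n : ℕ) (G : Graph n) → 3 ≤ n → MaxDegree G (n ∸ 2) →
    DominationNumber G 2
    × (∀ v m → DV G v m → m ≤ n ∸ 1)
    × (∀ v → deg G v ≡ n ∸ 2 → ∀ w → w ≢ v → ¬ Adj G v w →
         ∀ m → DV G v m → m ≡ ∣ N[_] G w ∣)
proposition2p10 n G 3≤n Δ≡n∸2 = γ≡2 , DV≤n∸1 , DV≡∣N[w]∣
  where open MaxDegree-n∸2 G 3≤n Δ≡n∸2
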